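{- Let $\tau\ge 2$ and $\kappa\ge 1$ be integers and let $x', x, l_2,\dots,l_{\tau-1}, x_1,\dots,x_\kappa \in \{0,1\}$. Then $$x' = 1 \text{ if and only if } \Big(\text{at least one of } x, l_2, \dots, l_{\tau-1} \text{ equals } 1\Big) \text{ or } \Big(x_1 = \cdots = x_\kappa = 1\Big)$$ holds if and only if both inequalities $$((\tau - 1)\kappa + 1)x' - \kappa\Big(x + \sum_{i=2}^{\tau-1} l_i\Big) - \sum_{i=1}^{\kappa} x_i + \kappa - 1 \ge 0$$ and $$-\kappa x' + \kappa\Big(x + \sum_{i=2}^{\tau-1} l_i\Big) + \sum_{i=1}^{\kappa} x_i \ge 0$$ are satisfied. (When $\tau=2$ the sums over $l_i$ are empty.)
   Context: In the paper's modelling of a deduction system, $x$ is a state variable (value $1$ = known, $0$ = unknown), $x'$ is its copy at the next deduction step, and $x$ has path variables $l_1,\dots,l_\tau$, where $l_1$ corresponds to copying $x$ itself, $l_2,\dots,l_{\tau-1}$ to other rules, and $l_\tau$ corresponds to a rule whose premises are the state variables $x_1,\dots,x_\kappa$ (so $l_\tau=1$ iff all $x_i=1$). The copy $x'$ is known exactly when $x$ is known, or some $l_i$ ($2\le i\le\tau-1$) is known, or all of $x_1,\dots,x_\kappa$ are known. -}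

module Defs where

open import Data.Nat using (ℕ; zero; suc; _+_)
open import Data.Fin using (Fin; zero; suc)

∑ : (n : ℕ) → (Fin n → ℕ) → ℕ
∑ zero f = 0
∑ (suc n) f = f zero + ∑ n (λ i → f (suc i))

module Submission where

-- Write S = x + l₂ + … + l_{τ-1}, T = x₁ + … + x_κ and
-- W = κ·S + T ("weighted count of known premises").  Because all variables are
-- bits, S ≥ 1 says that x or some l_i is known and T = κ says that all x_i are
-- known; since T ≤ κ, the disjunction of the two is equivalent to κ ≤ W.  The
-- deduction rule therefore reads "x′ = 1 ⇔ κ ≤ W".  After clearing the integer
-- subtractions the two inequalities become W + 1 ≤ x′·(κ(τ-1) + 1) + κ and
-- x′·κ ≤ W.  For x′ = 0 they say W < κ, and for x′ = 1 they say κ ≤ W (the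
-- first one then holds automatically, as W ≤ κ(τ-1) + κ); this is exactly the
-- rule.

open import Defs
open import Data.Nat using (ℕ; _≤_; _≥_; _∸_)
open import Data.Fin using (Fin)
open import Data.Integer using (ℤ; +_; _+_; _-_; _*_; -_) renaming (_≤_ to _≤ℤ_)
open import Data.Product using (_×_; ∃)
open import Data.Sum using (_⊎_)
open import Relation.Binary.PropositionalEquality using (_≡_)
open import Function.Bundles using (_⇔_)

import Data.Nat as ℕ
import Data.Nat.Properties as ℕP
import Data.Integer as ℤ
import Data.Integer.Properties as ℤP
open import Data.Integer.Tactic.RingSolver using (solve-∀)
import Data.Nat.Tactic.RingSolver as ℕTactic
open import Data.Fin using (zero; suc)
open import Data.Product using (_,_)
open import Data.Sum using (inj₁; inj₂)
open import Data.Product.Function.NonDependent.Propositional using (_×-⇔_)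
open import Data.Sum.Function.Propositional using (_⊎-⇔_)
open import Function.Bundles using (mk⇔; Equivalence)
open import Relation.Nullary using (contradiction)
open import Relation.Binary.PropositionalEquality
  using (refl; sym; cong; cong₂; subst; module ≡-Reasoning)
import Function.Properties.Equivalence as ⇔

open Equivalence using (to; from)

∑-bound : ∀ n (f : Fin n → ℕ) → (∀ i → f i ≤ 1) → ∑ n f ≤ n
∑-bound ℕ.zero    f bits = ℕ.z≤n
∑-bound (ℕ.suc n) f bits =
  ℕP.+-mono-≤ (bits zero) (∑-bound n (λ i → f (suc i)) (λ i → bits (suc i)))

∑-full : ∀ n (f : Fin n → ℕ) → (∀ i → f i ≤ 1) → (∑ n f ≡ n ⇔ (∀ i → f i ≡ 1))
∑-full n f bits = mk⇔ (all-one n f bits) (sum-full n f)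
  where
  all-one : ∀ n (f : Fin n → ℕ) → (∀ i → f i ≤ 1) → ∑ n f ≡ n → ∀ i → f i ≡ 1
  all-one (ℕ.suc n) f bits eq i with f zero in first | bits zero
  all-one (ℕ.suc n) f bits eq i | .0 | ℕ.z≤n =
    contradiction (subst (_≤ n) eq (∑-bound n (λ i → f (suc i)) (λ i → bits (suc i))))
                  (ℕP.<-irrefl refl)
  all-one (ℕ.suc n) f bits eq zero    | .1 | ℕ.s≤s ℕ.z≤n = first
  all-one (ℕ.suc n) f bits eq (suc i) | .1 | ℕ.s≤s ℕ.z≤n =
    all-one n (λ i → f (suc i)) (λ i → bits (suc i)) (ℕP.suc-injective eq) i
  sum-full : ∀ n (f : Fin n → ℕ) → (∀ i → f i ≡ 1) → ∑ n f ≡ n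
  sum-full ℕ.zero    f ones = refl
  sum-full (ℕ.suc n) f ones =
    cong₂ ℕ._+_ (ones zero) (sum-full n (λ i → f (suc i)) (λ i → ones (suc i)))

∑-positive : ∀ n (f : Fin n → ℕ) → (∀ i → f i ≤ 1) → ((∃ λ i → f i ≡ 1) ⇔ 1 ≤ ∑ n f)
∑-positive n f bits = mk⇔ (some-one⇒positive n f) (positive⇒some-one n f bits)
  where
  some-one⇒positive : ∀ n (f : Fin n → ℕ) → (∃ λ i → f i ≡ 1) → 1 ≤ ∑ n f
  some-one⇒positive (ℕ.suc n) f (zero , eq) =
    ℕP.≤-trans (ℕP.≤-reflexive (sym eq)) (ℕP.m≤m+n (f zero) _)
  some-one⇒positive (ℕ.suc n) f (suc i , eq) =
    ℕP.≤-trans (some-one⇒positive n (λ i → f (suc i)) (i , eq)) (ℕP.m≤n+m _ (f zero))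
  positive⇒some-one : ∀ n (f : Fin n → ℕ) → (∀ i → f i ≤ 1) → 1 ≤ ∑ n f → ∃ λ i → f i ≡ 1
  positive⇒some-one (ℕ.suc n) f bits pos with f zero in eq | bits zero
  ... | .1 | ℕ.s≤s ℕ.z≤n = zero , eq
  ... | .0 | ℕ.z≤n =
    let (i , eqᵢ) = positive⇒some-one n (λ i → f (suc i)) (λ i → bits (suc i)) pos
    in suc i , eqᵢ

some-known : ∀ n x (l : Fin n → ℕ) → x ≤ 1 → (∀ i → l i ≤ 1) →
             ((x ≡ 1 ⊎ ∃ λ i → l i ≡ 1) ⇔ 1 ≤ x ℕ.+ ∑ n l)
some-known n x l bit bits = ⇔.trans split (∑-positive (ℕ.suc n) (cons x l) cons-bits)
  where
  cons : ℕ → (Fin n → ℕ) → Fin (ℕ.suc n) → ℕ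
  cons x l zero    = x
  cons x l (suc i) = l i
  cons-bits : ∀ i → cons x l i ≤ 1
  cons-bits zero    = bit
  cons-bits (suc i) = bits i
  split : (x ≡ 1 ⊎ ∃ λ i → l i ≡ 1) ⇔ (∃ λ i → cons x l i ≡ 1)
  split = mk⇔ (λ { (inj₁ eq) → zero , eq ; (inj₂ (i , eq)) → suc i , eq })
              (λ { (zero , eq) → inj₁ eq ; (suc i , eq) → inj₂ (i , eq) })

count-threshold : ∀ κ S T → T ≤ κ → ((1 ≤ S ⊎ T ≡ κ) ⇔ κ ≤ κ ℕ.* S ℕ.+ T)
count-threshold κ S T T≤κ = mk⇔ reaches (reached S)
  where
  reaches : (1 ≤ S ⊎ T ≡ κ) → κ ≤ κ ℕ.* S ℕ.+ T
  reaches (inj₁ (ℕ.s≤s {n = s} _)) = ℕP.≤-trans (ℕP.m≤m*n κ (ℕ.suc s)) (ℕP.m≤m+n _ T)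
  reaches (inj₂ refl)               = ℕP.m≤n+m T (κ ℕ.* S)
  reached : ∀ S → κ ≤ κ ℕ.* S ℕ.+ T → (1 ≤ S ⊎ T ≡ κ)
  reached ℕ.zero    κ≤ = inj₂ (ℕP.≤-antisym T≤κ (subst (λ z → κ ≤ z ℕ.+ T) (ℕP.*-zeroʳ κ) κ≤))
  reached (ℕ.suc s) _  = inj₁ (ℕ.s≤s ℕ.z≤n)

linearisation : ∀ c κ W x′ → x′ ≤ 1 → W ≤ κ ℕ.* c ℕ.+ κ →
                ((ℕ.suc W ≤ x′ ℕ.* (κ ℕ.* c ℕ.+ 1) ℕ.+ κ) × (x′ ℕ.* κ ≤ W))
                  ⇔ (x′ ≡ 1 ⇔ κ ≤ W)
linearisation c κ W .0 ℕ.z≤n _ = mk⇔ below (λ rule → under-threshold rule , ℕ.z≤n)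
  where
  under-threshold : (0 ≡ 1 ⇔ κ ≤ W) → W ℕ.< κ
  under-threshold rule = ℕP.≰⇒> (λ κ≤W → ℕP.0≢1+n (from rule κ≤W))
  below : (W ℕ.< κ) × (0 ≤ W) → (0 ≡ 1 ⇔ κ ≤ W)
  below (W<κ , _) = mk⇔ (λ ()) (λ κ≤W → contradiction W<κ (ℕP.≤⇒≯ κ≤W))
linearisation c κ W .1 (ℕ.s≤s ℕ.z≤n) W≤ = mk⇔ above (λ rule → first-holds , second (to rule refl))
  where
  open ℕP.≤-Reasoning
  rearrange : ∀ κ c → ℕ.suc (κ ℕ.* c ℕ.+ κ) ≡ 1 ℕ.* (κ ℕ.* c ℕ.+ 1) ℕ.+ κ
  rearrange = ℕTactic.solve-∀
  first-holds : ℕ.suc W ≤ 1 ℕ.* (κ ℕ.* c ℕ.+ 1) ℕ.+ κ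
  first-holds = begin
    ℕ.suc W                         ≤⟨ ℕ.s≤s W≤ ⟩
    ℕ.suc (κ ℕ.* c ℕ.+ κ)           ≡⟨ rearrange κ c ⟩
    1 ℕ.* (κ ℕ.* c ℕ.+ 1) ℕ.+ κ     ∎
  second : κ ≤ W → 1 ℕ.* κ ≤ W
  second = subst (_≤ W) (sym (ℕP.*-identityˡ κ))
  above : (ℕ.suc W ≤ 1 ℕ.* (κ ℕ.* c ℕ.+ 1) ℕ.+ κ) × (1 ℕ.* κ ≤ W) → (1 ≡ 1 ⇔ κ ≤ W)
  above (_ , κ≤W) = mk⇔ (λ _ → subst (_≤ W) (ℕP.*-identityˡ κ) κ≤W) (λ _ → refl)

nonneg-difference : ∀ a b → (+ 0 ≤ℤ + a - + b) ⇔ b ≤ a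
nonneg-difference a b =
  mk⇔ (λ p → ℤP.drop‿+≤+ (ℤP.0≤i-j⇒j≤i p)) (λ q → ℤP.i≤j⇒0≤j-i (ℤ.+≤+ q))

first-inequality : ∀ t κ x′ S T →
  (+ 0 ≤ℤ (((+ ℕ.suc (ℕ.suc t) - + 1) * + κ + + 1) * + x′ - + κ * + S - + T + + κ - + 1))
    ⇔ (ℕ.suc (κ ℕ.* S ℕ.+ T) ≤ x′ ℕ.* (κ ℕ.* ℕ.suc t ℕ.+ 1) ℕ.+ κ)
first-inequality t κ x′ S T =
  subst (λ e → (+ 0 ≤ℤ e) ⇔ (ℕ.suc (κ ℕ.* S ℕ.+ T) ≤ x′ ℕ.* (κ ℕ.* ℕ.suc t ℕ.+ 1) ℕ.+ κ))
        (sym normal-form)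
        (nonneg-difference (x′ ℕ.* (κ ℕ.* ℕ.suc t ℕ.+ 1) ℕ.+ κ) (ℕ.suc (κ ℕ.* S ℕ.+ T)))
  where
  open ≡-Reasoning
  rearrange : ∀ t κ x′ S T →
    ((+ 1 + (+ 1 + t) - + 1) * κ + + 1) * x′ - κ * S - T + κ - + 1
      ≡ (x′ * (κ * (+ 1 + t) + + 1) + κ) - (+ 1 + (κ * S + T))
  rearrange = solve-∀
  normal-form :
    ((+ ℕ.suc (ℕ.suc t) - + 1) * + κ + + 1) * + x′ - + κ * + S - + T + + κ - + 1
      ≡ + (x′ ℕ.* (κ ℕ.* ℕ.suc t ℕ.+ 1) ℕ.+ κ) - + ℕ.suc (κ ℕ.* S ℕ.+ T)
  normal-form = begin
    ((+ ℕ.suc (ℕ.suc t) - + 1) * + κ + + 1) * + x′ - + κ * + S - + T + + κ - + 1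
      ≡⟨ rearrange (+ t) (+ κ) (+ x′) (+ S) (+ T) ⟩
    (+ x′ * (+ κ * + ℕ.suc t + + 1) + + κ) - (+ 1 + (+ κ * + S + + T))
      ≡⟨ cong₂ (λ a b → (+ x′ * (a + + 1) + + κ) - (+ 1 + (b + + T)))
               (sym (ℤP.pos-* κ (ℕ.suc t))) (sym (ℤP.pos-* κ S)) ⟩
    (+ x′ * + (κ ℕ.* ℕ.suc t ℕ.+ 1) + + κ) - (+ 1 + (+ (κ ℕ.* S) + + T))
      ≡⟨ cong (λ a → (a + + κ) - + ℕ.suc (κ ℕ.* S ℕ.+ T)) (sym (ℤP.pos-* x′ _)) ⟩
    + (x′ ℕ.* (κ ℕ.* ℕ.suc t ℕ.+ 1) ℕ.+ κ) - + ℕ.suc (κ ℕ.* S ℕ.+ T)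
      ∎

second-inequality : ∀ κ x′ S T →
  (+ 0 ≤ℤ ((- (+ κ * + x′)) + + κ * + S + + T)) ⇔ (x′ ℕ.* κ ≤ κ ℕ.* S ℕ.+ T)
second-inequality κ x′ S T =
  subst (λ e → (+ 0 ≤ℤ e) ⇔ (x′ ℕ.* κ ≤ κ ℕ.* S ℕ.+ T))
        (sym normal-form) (nonneg-difference (κ ℕ.* S ℕ.+ T) (x′ ℕ.* κ))
  where
  open ≡-Reasoning
  rearrange : ∀ κ x′ S T → (- (κ * x′)) + κ * S + T ≡ (κ * S + T) - x′ * κ
  rearrange = solve-∀
  normal-form : (- (+ κ * + x′)) + + κ * + S + + T ≡ + (κ ℕ.* S ℕ.+ T) - + (x′ ℕ.* κ)
  normal-form = begin
    (- (+ κ * + x′)) + + κ * + S + + T     ≡⟨ rearrange (+ κ) (+ x′) (+ S) (+ T) ⟩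
    (+ κ * + S + + T) - + x′ * + κ         ≡⟨ cong₂ (λ a b → (a + + T) - b)
                                                     (sym (ℤP.pos-* κ S)) (sym (ℤP.pos-* x′ κ)) ⟩
    + (κ ℕ.* S ℕ.+ T) - + (x′ ℕ.* κ)       ∎

⇔-congʳ : ∀ {A P Q : Set} → P ⇔ Q → (A ⇔ P) ⇔ (A ⇔ Q)
⇔-congʳ P⇔Q = mk⇔ (λ A⇔P → ⇔.trans A⇔P P⇔Q) (λ A⇔Q → ⇔.trans A⇔Q (⇔.sym P⇔Q))

theorem3 : (τ κ : ℕ) → τ ≥ 2 → κ ≥ 1 →
    (x′ x : ℕ) (l : Fin (τ ∸ 2) → ℕ) (xs : Fin κ → ℕ) →
    x′ ≤ 1 → x ≤ 1 → (∀ i → l i ≤ 1) → (∀ i → xs i ≤ 1) →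
    ((x′ ≡ 1 ⇔ ((x ≡ 1 ⊎ ∃ λ i → l i ≡ 1) ⊎ (∀ i → xs i ≡ 1)))
      ⇔
     ((+ 0 ≤ℤ (((+ τ - + 1) * + κ + + 1) * + x′ - + κ * (+ x + + ∑ (τ ∸ 2) l) - + ∑ κ xs + + κ - + 1))
      × (+ 0 ≤ℤ ((- (+ κ * + x′)) + + κ * (+ x + + ∑ (τ ∸ 2) l) + + ∑ κ xs))))
theorem3 (ℕ.suc (ℕ.suc t)) κ (ℕ.s≤s (ℕ.s≤s _)) _ x′ x l xs x′-bit x-bit l-bits xs-bits =
  ⇔.trans (⇔-congʳ rule-premise)
          (⇔.sym (⇔.trans (first-inequality t κ x′ S T ×-⇔ second-inequality κ x′ S T)
                          (linearisation (ℕ.suc t) κ W x′ x′-bit W-bound)))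
  where
  S = x ℕ.+ ∑ t l
  T = ∑ κ xs
  W = κ ℕ.* S ℕ.+ T
  T-bound : T ≤ κ
  T-bound = ∑-bound κ xs xs-bits
  rule-premise : ((x ≡ 1 ⊎ ∃ λ i → l i ≡ 1) ⊎ (∀ i → xs i ≡ 1)) ⇔ κ ≤ W
  rule-premise = ⇔.trans (some-known t x l x-bit l-bits ⊎-⇔ ⇔.sym (∑-full κ xs xs-bits))
                         (count-threshold κ S T T-bound)
  W-bound : W ≤ κ ℕ.* ℕ.suc t ℕ.+ κ
  W-bound = ℕP.+-mono-≤ (ℕP.*-monoʳ-≤ κ (ℕP.+-mono-≤ x-bit (∑-bound t l l-bits))) T-bound
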